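{- Let $G$ be a graph such that $V(G)$ is partitioned into maximal modules $S_1,\dots,S_m$, and let $H=G(Q_1,\dots,Q_m)$ be the clique skeleton of $G$. Let $\alpha$ be any $\chi$-coloring of $G$. Let $\beta_1,\beta_2$ be any two $\chi$-colorings of $H$ such that $\beta_1(Q_p)\subseteq\alpha(S_p)$ and $\beta_2(Q_p)\subseteq\alpha(S_p)$ for every $p\in[m]$. Then there is a path between $\beta_1$ and $\beta_2$ in $R_\ell(H)$ for every $\ell\ge\chi(H)+1$.
   Context: Graphs are finite and simple. A $k$-coloring of $G$ is a map $V(G)\to\{1,\dots,k\}$ giving adjacent vertices different colors; $\chi(G)$ is the chromatic number and a $\chi$-coloring of $G$ is a $\chi(G)$-coloring. $R_\ell(G)$ is the graph whose vertices are the $\ell$-colorings of $G$, two adjacent if they differ on exactly one vertex. For a coloring $\gamma$ and a vertex set $S$, $\gamma(S)$ is the set of colors used on $S$. A module is a non-empty $S\subseteq V(G)$ such that every vertex outside $S$ is adjacent to all or none of $S$; a maximal module is a module $S\subsetneq V(G)$ not contained in any larger module properly contained in $V(G)$. Given the partition of $V(G)$ into maximal modules $S_1,\dots,S_m$ (so for $p\ne q$, $S_p$ is either complete or anticomplete to $S_q$), the clique skeleton $G(Q_1,\dots,Q_m)$ is the graph obtained by replacing each $S_p$ by a clique $Q_p$ of size $\chi(G[S_p])$, where every vertex of $Q_p$ is adjacent to every vertex of $Q_q$ ($p\neq q$) exactly when $S_p$ is complete to $S_q$ in $G$. -}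

module Defs where

open import Data.Nat using (ℕ; suc; _≤_)
open import Data.Nat.Properties using (≤-trans; n≤1+n)
open import Data.Fin using (Fin; toℕ; inject≤)
open import Data.Product using (Σ; ∃; _×_; _,_; proj₁; proj₂)
open import Data.Sum using (_⊎_; inj₁; inj₂)
open import Relation.Nullary using (¬_)
open import Relation.Binary.PropositionalEquality using (_≡_; _≢_; refl; sym)

record Graph (V : Set) : Set₁ where
  field
    Adj    : V → V → Set
    adjSym : ∀ {u v} → Adj u v → Adj v u
    adjIrr : ∀ {v} → ¬ Adj v v
open Graph public

Proper : ∀ {V} (G : Graph V) {k : ℕ} → (V → Fin k) → Set
Proper G c = ∀ u v → Adj G u v → c u ≢ c v

Colorable : ∀ {V} (G : Graph V) → ℕ → Set
Colorable {V} G k = Σ (V → Fin k) (Proper G)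

IsChromatic : ∀ {V} (G : Graph V) → ℕ → Set
IsChromatic G k = Colorable G k × (∀ j → Colorable G j → k ≤ j)

Induced : ∀ {V} (G : Graph V) (S : V → Set) → Graph (Σ V S)
Induced G S = record
  { Adj = λ x y → Adj G (proj₁ x) (proj₁ y)
  ; adjSym = adjSym G
  ; adjIrr = adjIrr G }

IsModule : ∀ {V} (G : Graph V) (S : V → Set) → Set
IsModule {V} G S =
  (∃ λ v → S v) ×
  (∀ x → ¬ S x → (∀ s → S s → Adj G x s) ⊎ (∀ s → S s → ¬ Adj G x s))

IsProperSubset : ∀ {V : Set} (S : V → Set) → Set
IsProperSubset {V} S = ∃ λ v → ¬ S v

IsMaximalModule : ∀ {V} (G : Graph V) (S : V → Set) → Set₁
IsMaximalModule {V} G S =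
  IsModule G S × IsProperSubset S ×
  (∀ (T : V → Set) → IsModule G T → IsProperSubset T →
     (∀ v → S v → T v) → ∀ v → T v → S v)

Part : ∀ {n m} → (Fin n → Fin m) → Fin m → Fin n → Set
Part part p v = part v ≡ p

-- vertices of the clique skeleton: Q_p has sz p vertices
SkelV : ∀ {m} (sz : Fin m → ℕ) → Set
SkelV {m} sz = Σ (Fin m) (λ p → Fin (sz p))

Complete : ∀ {n m} (G : Graph (Fin n)) (part : Fin n → Fin m) → Fin m → Fin m → Set
Complete G part p q = ∀ u v → part u ≡ p → part v ≡ q → Adj G u v

SkelAdj : ∀ {n m} (G : Graph (Fin n)) (part : Fin n → Fin m) (sz : Fin m → ℕ) →
          SkelV sz → SkelV sz → Set
SkelAdj G part sz (p , i) (q , j) =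
  (p ≡ q × toℕ i ≢ toℕ j) ⊎ (p ≢ q × Complete G part p q)

private
  skelSym : ∀ {n m} (G : Graph (Fin n)) (part : Fin n → Fin m) (sz : Fin m → ℕ)
            {x y : SkelV sz} → SkelAdj G part sz x y → SkelAdj G part sz y x
  skelSym G part sz (inj₁ (e , d)) = inj₁ (sym e , λ h → d (sym h))
  skelSym G part sz (inj₂ (d , c)) =
    inj₂ ((λ h → d (sym h)) , λ u v pu pv → adjSym G (c v u pv pu))

  skelIrr : ∀ {n m} (G : Graph (Fin n)) (part : Fin n → Fin m) (sz : Fin m → ℕ)
            {x : SkelV sz} → ¬ SkelAdj G part sz x x
  skelIrr G part sz (inj₁ (_ , d)) = d refl
  skelIrr G part sz (inj₂ (d , _)) = d refl

Skeleton : ∀ {n m} (G : Graph (Fin n)) (part : Fin n → Fin m) (sz : Fin m → ℕ) →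
           Graph (SkelV sz)
Skeleton G part sz = record
  { Adj = SkelAdj G part sz
  ; adjSym = skelSym G part sz
  ; adjIrr = skelIrr G part sz }

DifferOnOne : ∀ {V : Set} {ℓ} → (V → Fin ℓ) → (V → Fin ℓ) → Set
DifferOnOne {V} a b = Σ V λ v → a v ≢ b v × (∀ w → w ≢ v → a w ≡ b w)

-- a walk in the reconfiguration graph R_ℓ(G) from a to b
-- (colourings identified pointwise; every vertex on the walk after a is proper)
data Path {V : Set} (G : Graph V) (ℓ : ℕ) : (V → Fin ℓ) → (V → Fin ℓ) → Set where
  done : ∀ {a b} → (∀ v → a v ≡ b v) → Path G ℓ a b
  step : ∀ {a b c} → Proper G b → DifferOnOne a b → Path G ℓ b c → Path G ℓ a c

lift : ∀ {V : Set} {k ℓ} → suc k ≤ ℓ → (V → Fin k) → (V → Fin ℓ)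
lift {k = k} le c v = inject≤ (c v) (≤-trans (n≤1+n k) le)

{-# OPTIONS --safe #-}
-- Since α is proper, α(S_p) and α(S_q) are disjoint whenever S_p is complete to S_q. Hence a
-- colouring of H is proper as soon as it is injective on every clique Q_p and gives Q_p only
-- colours of α(S_p) below χ(H); β₁ and β₂ are such colourings. Starting from β₁, give the vertices
-- their β₂-colours one at a time while keeping this invariant: if the wanted colour of x ∈ Q_p is
-- held by another y ∈ Q_p, exchange the colours of x and y through the spare colour χ(H) + 1
-- (y to the spare, x to its new colour, y to the old colour of x). The spare colour occurs only
-- once, so the two intermediate colourings are proper as well.
module Submission where

open import Defs
open import Data.Nat using (ℕ; suc; _≤_; _<_)
open import Data.Nat.Properties using (<-irrefl)
open import Data.Fin using (Fin; toℕ; fromℕ<) renaming (_≟_ to _≟ᶠ_)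
open import Data.Fin.Properties using (toℕ-injective; toℕ-fromℕ<; toℕ-inject≤; toℕ<n; inject≤-injective)
open import Data.Product using (∃; _×_; _,_; proj₁)
open import Data.Product.Properties using (≡-dec)
open import Data.Sum using (inj₁; inj₂)
open import Data.Empty using (⊥-elim)
open import Data.List using (List; []; _∷_; concatMap; map; allFin)
open import Data.List.Membership.Propositional using (_∈_; lose)
open import Data.List.Membership.Propositional.Properties using (∈-concatMap⁺; ∈-map⁺; ∈-allFin)
open import Data.List.Relation.Unary.Any using (here; there; any?; satisfied)
open import Function using (_∘_)
open import Relation.Nullary using (¬_; Dec; yes; no)
open import Relation.Nullary.Decidable using (_×-dec_; map′)
open import Relation.Unary using (Decidable)
open import Relation.Binary.Definitions using (DecidableEquality)
open import Relation.Binary.PropositionalEquality using (_≡_; _≢_; refl; sym; trans; cong; subst; module ≡-Reasoning)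

module _ {V : Set} {G : Graph V} {ℓ : ℕ} where

  path-refl : ∀ {a} → Path G ℓ a a
  path-refl = done λ _ → refl

  Path-respˡ : ∀ {a a′ c} → (∀ v → a v ≡ a′ v) → Path G ℓ a′ c → Path G ℓ a c
  Path-respˡ a≗a′ (done a′≗c) = done λ v → trans (a≗a′ v) (a′≗c v)
  Path-respˡ a≗a′ (step proper (v , differ , agree) p) =
    step proper (v , differ ∘ trans (sym (a≗a′ v)) , λ w w≢v → trans (a≗a′ w) (agree w w≢v)) p

  _◅◅_ : ∀ {a b c} → Path G ℓ a b → Path G ℓ b c → Path G ℓ a c
  done a≗b ◅◅ q = Path-respˡ a≗b q
  step proper differ p ◅◅ q = step proper differ (p ◅◅ q)

DifferOnOne-sym : ∀ {V : Set} {ℓ} {a b : V → Fin ℓ} → DifferOnOne a b → DifferOnOne b a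
DifferOnOne-sym (v , differ , agree) = v , differ ∘ sym , λ w w≢v → sym (agree w w≢v)

module Update {V : Set} (_≟_ : DecidableEquality V) where

  _[_↦_] : ∀ {A : Set} → (V → A) → V → A → V → A
  (f [ x ↦ a ]) z with z ≟ x
  ... | yes _ = a
  ... | no  _ = f z

  update-at : ∀ {A : Set} (f : V → A) x a → (f [ x ↦ a ]) x ≡ a
  update-at f x a with x ≟ x
  ... | yes _   = refl
  ... | no  x≢x = ⊥-elim (x≢x refl)

  update-elsewhere : ∀ {A : Set} (f : V → A) {x} a {z} → z ≢ x → (f [ x ↦ a ]) z ≡ f z
  update-elsewhere f {x} a {z} z≢x with z ≟ x
  ... | yes z≡x = ⊥-elim (z≢x z≡x)
  ... | no  _   = refl

  update-differOnOne : ∀ {ℓ} (f : V → Fin ℓ) {x c} → f x ≢ c → DifferOnOne f (f [ x ↦ c ])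
  update-differOnOne f {x} {c} fx≢c =
    x , (λ fx≡ → fx≢c (trans fx≡ (update-at f x c))) , λ w w≢x → sym (update-elsewhere f c w≢x)

  transpose : V → V → V → V
  transpose x y z with z ≟ x | z ≟ y
  ... | yes _ | _     = y
  ... | no  _ | yes _ = x
  ... | no  _ | no  _ = z

  transpose-first : ∀ x y → transpose x y x ≡ y
  transpose-first x y with x ≟ x
  ... | yes _   = refl
  ... | no  x≢x = ⊥-elim (x≢x refl)

  transpose-second : ∀ x y → transpose x y y ≡ x
  transpose-second x y with y ≟ x | y ≟ y
  ... | yes y≡x | _       = y≡x
  ... | no  _   | yes _   = refl
  ... | no  _   | no  y≢y = ⊥-elim (y≢y refl)

  transpose-other : ∀ {x y z} → z ≢ x → z ≢ y → transpose x y z ≡ z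
  transpose-other {x} {y} {z} z≢x z≢y with z ≟ x | z ≟ y
  ... | yes z≡x | _       = ⊥-elim (z≢x z≡x)
  ... | no  _   | yes z≡y = ⊥-elim (z≢y z≡y)
  ... | no  _   | no  _   = refl

  transpose-involutive : ∀ x y z → transpose x y (transpose x y z) ≡ z
  transpose-involutive x y z with z ≟ x | z ≟ y
  ... | yes refl | _        = transpose-second x y
  ... | no  _    | yes refl = transpose-first x y
  ... | no  z≢x  | no  z≢y  = transpose-other z≢x z≢y

  transpose-injective : ∀ x y {a b} → transpose x y a ≡ transpose x y b → a ≡ b
  transpose-injective x y {a} {b} ta≡tb = begin
    a                                   ≡⟨ sym (transpose-involutive x y a) ⟩
    transpose x y (transpose x y a)     ≡⟨ cong (transpose x y) ta≡tb ⟩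
    transpose x y (transpose x y b)     ≡⟨ transpose-involutive x y b ⟩
    b                                   ∎
    where open ≡-Reasoning

  transpose-preserves : ∀ {B : Set} (f : V → B) {x y} → f x ≡ f y → ∀ z → f (transpose x y z) ≡ f z
  transpose-preserves f {x} {y} fx≡fy z with z ≟ x | z ≟ y
  ... | yes refl | _        = sym fx≡fy
  ... | no  _    | yes refl = fx≡fy
  ... | no  _    | no  _    = refl

module SpareColour
  {V B : Set} (H : Graph V) (_≟_ : DecidableEquality V) (_≟ᴮ_ : DecidableEquality B)
  (vertices : List V) (∈-vertices : ∀ v → v ∈ vertices)
  (block : V → B) {ℓ : ℕ} (Palette : B → Fin ℓ → Set)
  (spare : Fin ℓ) (spare∉Palette : ∀ b → ¬ Palette b spare)
  (palettes-separate : ∀ {x y c} → Adj H x y →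
                       Palette (block x) c → Palette (block y) c → block x ≡ block y)
  where

  open Update _≟_

  Colouring : Set
  Colouring = V → Fin ℓ

  record Admissible (γ : Colouring) : Set where
    field
      in-palette      : ∀ x → Palette (block x) (γ x)
      block-injective : ∀ {x y} → block x ≡ block y → γ x ≡ γ y → x ≡ y

  open Admissible

  decide-∃ : ∀ {P : V → Set} → Decidable P → Dec (∃ P)
  decide-∃ P? = map′ satisfied (λ (v , Pv) → lose (∈-vertices v) Pv) (any? P? vertices)

  module _ {γ : Colouring} (adm : Admissible γ) where

    admissible⇒proper : Proper H γ
    admissible⇒proper x y x~y γx≡γy = adjIrr H (subst (Adj H x) (sym x≡y) x~y)
      where
      x≡y : x ≡ y
      x≡y = block-injective adm
        (palettes-separate x~y (in-palette adm x)
                               (subst (Palette (block y)) (sym γx≡γy) (in-palette adm y)))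
        γx≡γy

    admissible-avoids-spare : ∀ x → γ x ≢ spare
    admissible-avoids-spare x γx≡spare =
      spare∉Palette (block x) (subst (Palette (block x)) γx≡spare (in-palette adm x))

    admissible-update : ∀ {x c} → Palette (block x) c →
                        (∀ {z} → block z ≡ block x → γ z ≢ c) →
                        Admissible (γ [ x ↦ c ])
    in-palette (admissible-update {x} c∈Px _) z with z ≟ x
    ... | yes refl = c∈Px
    ... | no  _    = in-palette adm z
    block-injective (admissible-update {x} _ c-unused) {a} {b} a~b γ′a≡γ′b
      with a ≟ x | b ≟ x
    ... | yes a≡x | yes b≡x = trans a≡x (sym b≡x)
    ... | yes refl | no _   = ⊥-elim (c-unused (sym a~b) (sym γ′a≡γ′b))
    ... | no _ | yes refl   = ⊥-elim (c-unused a~b γ′a≡γ′b)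
    ... | no _ | no _       = block-injective adm a~b γ′a≡γ′b

    admissible-transpose : ∀ {x y} → block x ≡ block y → Admissible (γ ∘ transpose x y)
    in-palette (admissible-transpose {x} {y} x~y) z =
      subst (λ b → Palette b (γ (transpose x y z)))
            (transpose-preserves block x~y z) (in-palette adm (transpose x y z))
    block-injective (admissible-transpose {x} {y} x~y) {a} {b} a~b γ′a≡γ′b =
      transpose-injective x y (block-injective adm tblock γ′a≡γ′b)
      where
      tblock : block (transpose x y a) ≡ block (transpose x y b)
      tblock = trans (transpose-preserves block x~y a)
                     (trans a~b (sym (transpose-preserves block x~y b)))

  proper-update-spare : ∀ {γ} → Proper H γ → (∀ x → γ x ≢ spare) → ∀ y → Proper H (γ [ y ↦ spare ])
  proper-update-spare {γ} proper avoids y u v u~v γ′u≡γ′v with u ≟ y | v ≟ y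
  ... | yes refl | yes refl = adjIrr H u~v
  ... | yes refl | no _     = avoids v (sym γ′u≡γ′v)
  ... | no _     | yes refl = avoids u γ′u≡γ′v
  ... | no _     | no _     = proper u v u~v γ′u≡γ′v

  recolour : ∀ {γ δ x c} → Proper H (γ [ x ↦ c ]) → γ x ≢ c →
             Path H ℓ (γ [ x ↦ c ]) δ → Path H ℓ γ δ
  recolour {γ} proper γx≢c = step proper (update-differOnOne γ γx≢c)

  swap-via-spare : ∀ {γ x y} → Admissible γ → block x ≡ block y → x ≢ y →
                   Path H ℓ γ (γ ∘ transpose x y)
  -- γ → γ[y ↦ spare] → γ′[y ↦ spare] → γ′, where the middle step recolours only x.
  swap-via-spare {γ} {x} {y} adm x~y x≢y =
    recolour (proper-update-spare (admissible⇒proper adm) avoids y) (avoids y)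
      (step (proper-update-spare (admissible⇒proper adm′) avoids′ y) (x , γx≢γy , agree)
        (step (admissible⇒proper adm′) (DifferOnOne-sym (update-differOnOne γ′ (avoids′ y)))
          path-refl))
    where
    γ′ : Colouring
    γ′ = γ ∘ transpose x y
    adm′ : Admissible γ′
    adm′ = admissible-transpose adm x~y
    avoids : ∀ z → γ z ≢ spare
    avoids = admissible-avoids-spare adm
    avoids′ : ∀ z → γ′ z ≢ spare
    avoids′ = admissible-avoids-spare adm′
    γx≢γy : (γ [ y ↦ spare ]) x ≢ (γ′ [ y ↦ spare ]) x
    γx≢γy rewrite update-elsewhere γ spare x≢y | update-elsewhere γ′ spare x≢y
                | transpose-first x y = x≢y ∘ block-injective adm x~y
    agree : ∀ w → w ≢ x → (γ [ y ↦ spare ]) w ≡ (γ′ [ y ↦ spare ]) w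
    agree w w≢x with w ≟ y
    ... | yes _   = refl
    ... | no  w≢y = cong γ (sym (transpose-other w≢x w≢y))

  module Towards (τ : Colouring) (adm-τ : Admissible τ) where

    Agrees : Colouring → V → Set
    Agrees γ z = γ z ≡ τ z

    record Improvement (γ : Colouring) (Fixed : V → Set) : Set where
      constructor improvement
      field
        {result}   : Colouring
        path       : Path H ℓ γ result
        admissible : Admissible result
        fixes      : ∀ {z} → Fixed z → Agrees result z
        preserves  : ∀ {z} → Agrees γ z → Agrees result z

    open Improvement

    fix-directly : ∀ {γ x} → Admissible γ → γ x ≢ τ x →
                   (∀ {z} → block z ≡ block x → γ z ≢ τ x) → Improvement γ (_≡ x)
    fix-directly {γ} {x} adm disagrees unused = improvement
      (recolour (admissible⇒proper adm′) disagrees path-refl) adm′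
      (λ { refl → update-at γ x (τ x) })
      (λ agrees → trans (update-elsewhere γ (τ x) (λ { refl → disagrees agrees })) agrees)
      where
      adm′ : Admissible (γ [ x ↦ τ x ])
      adm′ = admissible-update adm (in-palette adm-τ x) unused

    fix-by-swap : ∀ {γ x y} → Admissible γ → γ x ≢ τ x →
                  block y ≡ block x → γ y ≡ τ x → Improvement γ (_≡ x)
    fix-by-swap {γ} {x} {y} adm disagrees y~x γy≡τx = improvement
      (swap-via-spare adm (sym y~x) x≢y) (admissible-transpose adm (sym y~x))
      (λ { refl → trans (cong γ (transpose-first x y)) γy≡τx })
      preserved
      where
      x≢y : x ≢ y
      x≢y refl = disagrees γy≡τx
      preserved : ∀ {z} → Agrees γ z → Agrees (γ ∘ transpose x y) z
      preserved {z} agrees with z ≟ x | z ≟ y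
      ... | yes refl | _        = ⊥-elim (disagrees agrees)
      ... | no z≢x   | yes refl = ⊥-elim (z≢x (block-injective adm-τ y~x (trans (sym agrees) γy≡τx)))
      ... | no _     | no _     = agrees

    fix-vertex : ∀ {γ} → Admissible γ → ∀ x → Improvement γ (_≡ x)
    fix-vertex {γ} adm x with γ x ≟ᶠ τ x
    ... | yes agrees = improvement path-refl adm (λ { refl → agrees }) (λ agrees′ → agrees′)
    ... | no disagrees with decide-∃ (λ y → (block y ≟ᴮ block x) ×-dec (γ y ≟ᶠ τ x))
    ...   | no unused              = fix-directly adm disagrees λ z~x γz≡τx → unused (_ , z~x , γz≡τx)
    ...   | yes (y , y~x , γy≡τx) = fix-by-swap adm disagrees y~x γy≡τx

    fix-all : ∀ {γ} → Admissible γ → (L : List V) → Improvement γ (_∈ L)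
    fix-all adm [] = improvement path-refl adm (λ ()) (λ agrees → agrees)
    fix-all {γ} adm (x ∷ L) =
      improvement (path first ◅◅ path rest) (admissible rest) fixed (preserves rest ∘ preserves first)
      where
      first : Improvement γ (_≡ x)
      first = fix-vertex adm x
      rest : Improvement (result first) (_∈ L)
      rest = fix-all (admissible first) L
      fixed : ∀ {z} → z ∈ x ∷ L → Agrees (result rest) z
      fixed (here refl) = preserves rest (fixes first refl)
      fixed (there z∈L) = fixes rest z∈L

    recolour-to : ∀ {γ} → Admissible γ → Path H ℓ γ τ
    recolour-to {γ} adm = path improved ◅◅ done λ z → fixes improved (∈-vertices z)
      where
      improved : Improvement γ (_∈ vertices)
      improved = fix-all adm vertices

skeleton-vertices : ∀ {m} (sz : Fin m → ℕ) → List (SkelV sz)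
skeleton-vertices {m} sz = concatMap (λ p → map (p ,_) (allFin (sz p))) (allFin m)

∈-skeleton-vertices : ∀ {m} {sz : Fin m → ℕ} (x : SkelV sz) → x ∈ skeleton-vertices sz
∈-skeleton-vertices {sz = sz} (p , i) =
  ∈-concatMap⁺ (λ q → map (q ,_) (allFin (sz q))) (lose (∈-allFin p) (∈-map⁺ (p ,_) (∈-allFin i)))

module SkeletonRecolouring
  {n m} (G : Graph (Fin n)) (part : Fin n → Fin m) (sz : Fin m → ℕ)
  {k} {α : Fin n → Fin k} (α-proper : Proper G α) {kH ℓ} (le : suc kH ≤ ℓ)
  where

  H : Graph (SkelV sz)
  H = Skeleton G part sz

  -- Colours below kH are those of lifted kH-colourings; the spare colour is kH itself.
  Palette : Fin m → Fin ℓ → Set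
  Palette p c = toℕ c < kH × ∃ λ v → part v ≡ p × toℕ (α v) ≡ toℕ c

  spare : Fin ℓ
  spare = fromℕ< le

  spare∉Palette : ∀ p → ¬ Palette p spare
  spare∉Palette _ (spare<kH , _) = <-irrefl (toℕ-fromℕ< le) spare<kH

  palettes-separate : ∀ {x y c} → Adj H x y →
                      Palette (proj₁ x) c → Palette (proj₁ y) c → proj₁ x ≡ proj₁ y
  palettes-separate (inj₁ (p≡q , _)) _ _ = p≡q
  palettes-separate (inj₂ (_ , complete)) (_ , v , v∈p , αv≡c) (_ , w , w∈q , αw≡c) =
    ⊥-elim (α-proper v w (complete v w v∈p w∈q) (toℕ-injective (trans αv≡c (sym αw≡c))))

  open SpareColour H (≡-dec _≟ᶠ_ _≟ᶠ_) _≟ᶠ_ (skeleton-vertices sz) ∈-skeleton-vertices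
                   proj₁ Palette spare spare∉Palette palettes-separate public

  lift-admissible : (β : SkelV sz → Fin kH) → Proper H β →
                    (∀ p i → ∃ λ v → part v ≡ p × toℕ (α v) ≡ toℕ (β (p , i))) →
                    Admissible (lift le β)
  Admissible.in-palette (lift-admissible β _ β⊆α) (p , i) =
    subst (_< kH) (sym toℕ-lift) (toℕ<n (β (p , i))) ,
    let v , v∈p , αv≡β = β⊆α p i in v , v∈p , trans αv≡β (sym toℕ-lift)
    where
    toℕ-lift : toℕ (lift le β (p , i)) ≡ toℕ (β (p , i))
    toℕ-lift = toℕ-inject≤ (β (p , i)) _
  Admissible.block-injective (lift-admissible β β-proper _) {p , i} {.p , j} refl βi≡βj
    with i ≟ᶠ j
  ... | yes refl = refl
  ... | no  i≢j  = ⊥-elim (β-proper (p , i) (p , j) (inj₁ (refl , i≢j ∘ toℕ-injective))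
                                    (inject≤-injective _ _ (β (p , i)) (β (p , j)) βi≡βj))

lemma3 : ∀ {n m} (G : Graph (Fin n)) (part : Fin n → Fin m) →
    (∀ p → IsMaximalModule G (Part part p)) →
    (sz : Fin m → ℕ) → (∀ p → IsChromatic (Induced G (Part part p)) (sz p)) →
    (k : ℕ) → IsChromatic G k → (α : Fin n → Fin k) → Proper G α →
    (kH : ℕ) → IsChromatic (Skeleton G part sz) kH →
    (β₁ β₂ : SkelV sz → Fin kH) →
    Proper (Skeleton G part sz) β₁ → Proper (Skeleton G part sz) β₂ →
    (∀ p i → ∃ λ v → part v ≡ p × toℕ (α v) ≡ toℕ (β₁ (p , i))) →
    (∀ p i → ∃ λ v → part v ≡ p × toℕ (α v) ≡ toℕ (β₂ (p , i))) →
    (ℓ : ℕ) → (le : suc kH ≤ ℓ) →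
    Path (Skeleton G part sz) ℓ (lift le β₁) (lift le β₂)
-- Only the properness of α, β₁, β₂ and the inclusions βᵢ(Q_p) ⊆ α(S_p) are needed.
lemma3 G part _ sz _ _ _ α α-proper _ _ β₁ β₂ β₁-proper β₂-proper β₁⊆α β₂⊆α _ le =
  Towards.recolour-to (lift le β₂) (lift-admissible β₂ β₂-proper β₂⊆α)
                                   (lift-admissible β₁ β₁-proper β₁⊆α)
  where open SkeletonRecolouring G part sz α-proper le
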